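{- Let $f:\{0,1\}^n\to\{0,1\}$ and $\varepsilon>\delta>0$. Then $$\log\mathsf{qprt}_\delta(f)\le O\!\left(\frac1{(0.5-\varepsilon)^2}\log\frac1\delta\right)\log\mathsf{qprt}_\varepsilon(f).$$
   Context: For $s\in\{0,1,\star\}^n$, the subcube with support $s$ is $\{x:s_i\ne\star\Rightarrow x_i=s_i\}$, and $|A|$ denotes the number of non-$\star$ coordinates of the support of subcube $A$. $\mathsf{qprt}_\varepsilon(f)$ is the optimal value of the LP: minimize $\sum_{z\in\{0,1\}}\sum_A w_{z,A}2^{|A|}$ over $w_{z,A}\ge0$ ($A$ ranging over subcubes) subject to $\sum_{A\ni x}w_{f(x),A}\ge1-\varepsilon$ and $\sum_{A\ni x}\sum_zw_{z,A}=1$ for all $x\in\{0,1\}^n$. Logarithms base 2; the constant in $O(\cdot)$ is absolute.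
   Formalization: The parameters ε and δ and the weights $w_{z,A}$ of the linear program defining $\mathsf{qprt}_\varepsilon(f)$ are rational. -}

module Defs where

open import Data.Bool using (Bool; true; false; if_then_else_; _∧_)
open import Data.Nat as ℕ using (ℕ; zero; suc)
open import Data.Integer using (+_)
open import Data.List using (List; []; _∷_; map; concatMap; foldr)
open import Data.Vec using (Vec; []; _∷_)
open import Data.Product using (_×_; Σ; ∃-syntax)
open import Data.Rational using (ℚ; 0ℚ; 1ℚ; _+_; _*_; _-_; _≤_; _<_)
open import Relation.Binary.PropositionalEquality using (_≡_)

-- A coordinate of a subcube support: fixed to a bit, or ⋆ (free).
data Sym : Set where
  fix : Bool → Sym
  ⋆   : Sym

Cube : ℕ → Set
Cube n = Vec Bool n

Support : ℕ → Set
Support n = Vec Sym n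

-- The complete list of all 3^n supports (each exactly once).
allSupports : (n : ℕ) → List (Support n)
allSupports zero    = [] ∷ []
allSupports (suc n) =
  concatMap (λ s → (fix false ∷ s) ∷ (fix true ∷ s) ∷ (⋆ ∷ s) ∷ []) (allSupports n)

_==B_ : Bool → Bool → Bool
true  ==B true  = true
false ==B false = true
_     ==B _     = false

_∈C_ : {n : ℕ} → Cube n → Support n → Bool
[]      ∈C []      = true
(b ∷ x) ∈C (fix c ∷ s) = (b ==B c) ∧ (x ∈C s)
(b ∷ x) ∈C (⋆ ∷ s)     = x ∈C s

dim : {n : ℕ} → Support n → ℕ
dim []          = 0
dim (fix _ ∷ s) = suc (dim s)
dim (⋆ ∷ s)     = dim s

sumℚ : List ℚ → ℚ
sumℚ = foldr _+_ 0ℚ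

_^ℚ_ : ℚ → ℕ → ℚ
q ^ℚ zero  = 1ℚ
q ^ℚ suc k = q * (q ^ℚ k)

ℕtoℚ : ℕ → ℚ
ℕtoℚ k = + k Data.Rational./ 1

Weights : ℕ → Set
Weights n = Bool → Support n → ℚ

cover : {n : ℕ} → Weights n → Bool → Cube n → ℚ
cover {n} w z x = sumℚ (map (λ A → if x ∈C A then w z A else 0ℚ) (allSupports n))

cost : {n : ℕ} → Weights n → ℚ
cost {n} w = sumℚ (map (λ A → (w false A + w true A) * (ℕtoℚ 2 ^ℚ dim A)) (allSupports n))

-- Feasibility for the LP defining qprt_ε(f).
Feasible : {n : ℕ} → (Cube n → Bool) → ℚ → Weights n → Set
Feasible {n} f ε w =
  ((z : Bool) (A : Support n) → 0ℚ ≤ w z A) ×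
  ((x : Cube n) → 1ℚ - ε ≤ cover w (f x) x) ×
  ((x : Cube n) → cover w false x + cover w true x ≡ 1ℚ)

-- Amplification by majority vote. Drawing t labelled subcubes from a partition
-- w and intersecting them gives a new partition, indexed by sequences of t
-- labelled subcubes, with the product of their weights as weight and the
-- majority of their labels as label. As |A ∩ B| ≤ |A| + |B| its cost is at most
-- cost(w)^t. Let x be a point whose correct label has cover c ≥ 1 - ε. Summing
-- weight · ε^(#correct) · (1 - ε)^(#wrong) over the sequences covering x gives
-- (ε c + (1 - ε)(1 - c))^t ≤ (2ε(1 - ε))^t, while each sequence with a wrong
-- majority contributes at least (ε(1 - ε))^(t/2) per unit of weight. So the wrong
-- mass at x is at most (4ε(1 - ε))^(t/2) = (1 - 4(½ - ε)²)^(t/2). This is ≤ δ for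
-- t = 2js with s·4(½ - ε)² ∈ [1, 2] and j the least integer with δ·2^j ≥ 1, so
-- the cost grows to at most cost(w)^t with t ≤ j/(½ - ε)², and C = 1 works.

{-# OPTIONS --safe #-}
module Submission where

open import Defs
open import Algebra.Bundles using (CommutativeRing)
open import Data.Bool using (Bool; true; false; if_then_else_; _∧_; not; T)
open import Data.Bool.Properties using (∧-zeroʳ; ∧-identityʳ)
open import Data.Empty using (⊥-elim)
import Data.Integer as ℤ
import Data.Integer.Properties as ℤ
open import Data.List using (List; []; _∷_; _++_; map; concatMap; fromMaybe)
open import Data.List.Relation.Unary.All as All using (All; []; _∷_)
open import Data.List.Relation.Unary.All.Properties using (concat⁺; map⁺)
open import Data.Maybe as Maybe using (Maybe; just; nothing; zipWith; maybe′)
open import Data.Nat as ℕ using (ℕ; zero; suc)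
open import Data.Nat.Induction using (<-rec)
import Data.Nat.Properties as ℕ
open import Data.Nat.Tactic.RingSolver using (solve-∀)
open import Data.Product using (_×_; _,_; proj₁; ∃-syntax)
open import Data.Rational
  using (ℚ; mkℚ; 0ℚ; 1ℚ; ½; _+_; _*_; -_; _-_; _≤_; _<_; _≤?_; *<*; toℚᵘ; nonNegative; positive)
open import Data.Rational.Properties
open import Data.Rational.Solver using (module +-*-Solver)
import Data.Rational.Unnormalised as ℚᵘ
import Data.Rational.Unnormalised.Properties as ℚᵘ
open import Data.Unit using (tt)
open import Data.Vec using ([]; _∷_; replicate)
open import Relation.Binary.PropositionalEquality
  using (_≡_; refl; sym; trans; cong; cong₂; subst; subst₂; module ≡-Reasoning)
open import Relation.Nullary using (yes; no; ¬_)
open import Relation.Unary using (Decidable)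
import Algebra.Properties.CommutativeSemiring.Exp (CommutativeRing.commutativeSemiring +-*-commutativeRing) as Exp

open +-*-Solver using (solve; _:+_; _:*_; _:-_; _:=_; con)

*-nonneg : ∀ {p q} → 0ℚ ≤ p → 0ℚ ≤ q → 0ℚ ≤ p * q
*-nonneg {p} {q} 0≤p 0≤q = subst (_≤ p * q) (*-zeroˡ q) (*-monoʳ-≤-nonNeg q {{nonNegative 0≤q}} 0≤p)

*-pos : ∀ {p q} → 0ℚ < p → 0ℚ < q → 0ℚ < p * q
*-pos {p} {q} 0<p 0<q = subst (_< p * q) (*-zeroʳ p) (*-monoʳ-<-pos p {{positive 0<p}} 0<q)

+-nonneg : ∀ {p q} → 0ℚ ≤ p → 0ℚ ≤ q → 0ℚ ≤ p + q
+-nonneg = +-mono-≤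

*-monoˡ-≤-nonneg : ∀ {p q} r → 0ℚ ≤ r → p ≤ q → r * p ≤ r * q
*-monoˡ-≤-nonneg r 0≤r = *-monoˡ-≤-nonNeg r {{nonNegative 0≤r}}

*-monoʳ-≤-nonneg : ∀ {p q} r → 0ℚ ≤ r → p ≤ q → p * r ≤ q * r
*-monoʳ-≤-nonneg r 0≤r = *-monoʳ-≤-nonNeg r {{nonNegative 0≤r}}

*-mono-≤-nonneg : ∀ {p q r s} → 0ℚ ≤ p → 0ℚ ≤ r → p ≤ q → r ≤ s → p * r ≤ q * s
*-mono-≤-nonneg {q = q} {r} 0≤p 0≤r p≤q r≤s =
  ≤-trans (*-monoʳ-≤-nonneg r 0≤r p≤q) (*-monoˡ-≤-nonneg q (≤-trans 0≤p p≤q) r≤s)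

0≤1 : 0ℚ ≤ 1ℚ
0≤1 = nonNegative⁻¹ 1ℚ

1≤2 : 1ℚ ≤ ℕtoℚ 2
1≤2 = ≤ᵇ⇒≤ tt

p≤1+p : ∀ p → p ≤ 1ℚ + p
p≤1+p p = subst (_≤ 1ℚ + p) (+-identityˡ p) (+-monoˡ-≤ p 0≤1)

p≤q⇒0≤q-p : ∀ {p q} → p ≤ q → 0ℚ ≤ q - p
p≤q⇒0≤q-p {p} {q} p≤q = subst (_≤ q - p) (+-inverseʳ p) (+-monoˡ-≤ (- p) p≤q)

p<q⇒0<q-p : ∀ {p q} → p < q → 0ℚ < q - p
p<q⇒0<q-p {p} {q} p<q = subst (_< q - p) (+-inverseʳ p) (+-monoˡ-< (- p) p<q)

0≤q-p⇒p≤q : ∀ {p q} → 0ℚ ≤ q - p → p ≤ q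
0≤q-p⇒p≤q {p} {q} 0≤q-p = subst₂ _≤_ (+-identityˡ p) (q-p+p≡q p q) (+-monoˡ-≤ p 0≤q-p)
  where
  q-p+p≡q : ∀ p q → (q - p) + p ≡ q
  q-p+p≡q = solve 2 (λ p q → (q :- p) :+ p := q) refl

*-interchange : ∀ a b c d → (a * b) * (c * d) ≡ (a * c) * (b * d)
*-interchange = solve 4 (λ a b c d → (a :* b) :* (c :* d) := (a :* c) :* (b :* d)) refl

^ℚ≡^ : ∀ q k → q ^ℚ k ≡ q Exp.^ k
^ℚ≡^ q zero    = refl
^ℚ≡^ q (suc k) = cong (q *_) (^ℚ≡^ q k)

^-+ : ∀ q a b → q ^ℚ (a ℕ.+ b) ≡ q ^ℚ a * q ^ℚ b
^-+ q a b rewrite ^ℚ≡^ q (a ℕ.+ b) | ^ℚ≡^ q a | ^ℚ≡^ q b = Exp.^-homo-* q a b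

^-* : ∀ q a b → q ^ℚ (a ℕ.* b) ≡ (q ^ℚ b) ^ℚ a
^-* q a b rewrite ^ℚ≡^ (q ^ℚ b) a | ^ℚ≡^ q b | ^ℚ≡^ q (a ℕ.* b) | ℕ.*-comm a b = sym (Exp.^-assocʳ q b a)

^-distrib-* : ∀ p q k → (p * q) ^ℚ k ≡ p ^ℚ k * q ^ℚ k
^-distrib-* p q k rewrite ^ℚ≡^ (p * q) k | ^ℚ≡^ p k | ^ℚ≡^ q k = Exp.^-distrib-* p q k

1^ : ∀ k → 1ℚ ^ℚ k ≡ 1ℚ
1^ zero    = refl
1^ (suc k) = trans (*-identityˡ _) (1^ k)

^-nonneg : ∀ {q} k → 0ℚ ≤ q → 0ℚ ≤ q ^ℚ k
^-nonneg zero    0≤q = 0≤1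
^-nonneg (suc k) 0≤q = *-nonneg 0≤q (^-nonneg k 0≤q)

^-pos : ∀ {q} k → 0ℚ < q → 0ℚ < q ^ℚ k
^-pos zero    0<q = positive⁻¹ 1ℚ
^-pos (suc k) 0<q = *-pos 0<q (^-pos k 0<q)

^-monoˡ-≤ : ∀ {p q} k → 0ℚ ≤ p → p ≤ q → p ^ℚ k ≤ q ^ℚ k
^-monoˡ-≤ zero    0≤p p≤q = ≤-refl
^-monoˡ-≤ (suc k) 0≤p p≤q = *-mono-≤-nonneg 0≤p (^-nonneg k 0≤p) p≤q (^-monoˡ-≤ k 0≤p p≤q)

1≤^ : ∀ {q} k → 1ℚ ≤ q → 1ℚ ≤ q ^ℚ k
1≤^ {q} k 1≤q = subst (_≤ q ^ℚ k) (1^ k) (^-monoˡ-≤ k 0≤1 1≤q)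

^≤1 : ∀ {q} k → 0ℚ ≤ q → q ≤ 1ℚ → q ^ℚ k ≤ 1ℚ
^≤1 {q} k 0≤q q≤1 = subst (q ^ℚ k ≤_) (1^ k) (^-monoˡ-≤ k 0≤q q≤1)

^-monoʳ-≤ : ∀ {q} {a b} → 1ℚ ≤ q → a ℕ.≤ b → q ^ℚ a ≤ q ^ℚ b
^-monoʳ-≤ {q} {a} {b} 1≤q a≤b = begin
  q ^ℚ a                       ≡⟨ sym (*-identityʳ _) ⟩
  q ^ℚ a * 1ℚ                  ≤⟨ *-monoˡ-≤-nonneg (q ^ℚ a) (^-nonneg a (≤-trans 0≤1 1≤q)) (1≤^ (b ℕ.∸ a) 1≤q) ⟩
  q ^ℚ a * q ^ℚ (b ℕ.∸ a)      ≡⟨ sym (^-+ q a (b ℕ.∸ a)) ⟩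
  q ^ℚ (a ℕ.+ (b ℕ.∸ a))       ≡⟨ cong (q ^ℚ_) (ℕ.m+[n∸m]≡n a≤b) ⟩
  q ^ℚ b                       ∎
  where open ≤-Reasoning

ℕtoℚ-suc : ∀ k → ℕtoℚ (suc k) ≡ 1ℚ + ℕtoℚ k
ℕtoℚ-suc k = toℚᵘ-injective (begin
  toℚᵘ (ℕtoℚ (suc k))               ≈⟨ toℚᵘ-fromℚᵘ (ℚᵘ.mkℚᵘ (ℤ.+ suc k) 0) ⟩
  ℚᵘ.mkℚᵘ (ℤ.+ suc k) 0              ≈⟨ ℚᵘ.*≡* (trans (ℤ.*-identityʳ _) (sym (trans (ℤ.*-identityʳ _)
                                                  (cong (ℤ._+_ ℤ.1ℤ) (ℤ.*-identityʳ (ℤ.+ k)))))) ⟩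
  toℚᵘ 1ℚ ℚᵘ.+ ℚᵘ.mkℚᵘ (ℤ.+ k) 0      ≈⟨ ℚᵘ.+-congʳ (toℚᵘ 1ℚ) (ℚᵘ.≃-sym (toℚᵘ-fromℚᵘ (ℚᵘ.mkℚᵘ (ℤ.+ k) 0))) ⟩
  toℚᵘ 1ℚ ℚᵘ.+ toℚᵘ (ℕtoℚ k)         ≈⟨ ℚᵘ.≃-sym (toℚᵘ-homo-+ 1ℚ (ℕtoℚ k)) ⟩
  toℚᵘ (1ℚ + ℕtoℚ k)                 ∎)
  where open ℚᵘ.≃-Reasoning

ℕtoℚ-+ : ∀ m n → ℕtoℚ (m ℕ.+ n) ≡ ℕtoℚ m + ℕtoℚ n
ℕtoℚ-+ zero    n = sym (+-identityˡ (ℕtoℚ n))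
ℕtoℚ-+ (suc m) n = begin
  ℕtoℚ (suc (m ℕ.+ n))            ≡⟨ ℕtoℚ-suc (m ℕ.+ n) ⟩
  1ℚ + ℕtoℚ (m ℕ.+ n)             ≡⟨ cong (1ℚ +_) (ℕtoℚ-+ m n) ⟩
  1ℚ + (ℕtoℚ m + ℕtoℚ n)          ≡⟨ sym (+-assoc 1ℚ (ℕtoℚ m) (ℕtoℚ n)) ⟩
  (1ℚ + ℕtoℚ m) + ℕtoℚ n          ≡⟨ cong (_+ ℕtoℚ n) (sym (ℕtoℚ-suc m)) ⟩
  ℕtoℚ (suc m) + ℕtoℚ n           ∎
  where open ≡-Reasoning

ℕtoℚ-* : ∀ m n → ℕtoℚ (m ℕ.* n) ≡ ℕtoℚ m * ℕtoℚ n
ℕtoℚ-* zero    n = sym (*-zeroˡ (ℕtoℚ n))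
ℕtoℚ-* (suc m) n = begin
  ℕtoℚ (n ℕ.+ m ℕ.* n)                 ≡⟨ ℕtoℚ-+ n (m ℕ.* n) ⟩
  ℕtoℚ n + ℕtoℚ (m ℕ.* n)              ≡⟨ cong (ℕtoℚ n +_) (ℕtoℚ-* m n) ⟩
  ℕtoℚ n + ℕtoℚ m * ℕtoℚ n             ≡⟨ cong (_+ ℕtoℚ m * ℕtoℚ n) (sym (*-identityˡ (ℕtoℚ n))) ⟩
  1ℚ * ℕtoℚ n + ℕtoℚ m * ℕtoℚ n        ≡⟨ sym (*-distribʳ-+ (ℕtoℚ n) 1ℚ (ℕtoℚ m)) ⟩
  (1ℚ + ℕtoℚ m) * ℕtoℚ n               ≡⟨ cong (_* ℕtoℚ n) (sym (ℕtoℚ-suc m)) ⟩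
  ℕtoℚ (suc m) * ℕtoℚ n                ∎
  where open ≡-Reasoning

ℕtoℚ-nonneg : ∀ k → 0ℚ ≤ ℕtoℚ k
ℕtoℚ-nonneg zero    = ≤-refl
ℕtoℚ-nonneg (suc k) = subst (0ℚ ≤_) (sym (ℕtoℚ-suc k)) (≤-trans (ℕtoℚ-nonneg k) (p≤1+p (ℕtoℚ k)))

ℕtoℚ-mono-≤ : ∀ {m n} → m ℕ.≤ n → ℕtoℚ m ≤ ℕtoℚ n
ℕtoℚ-mono-≤ {m} {n} m≤n = begin
  ℕtoℚ m                          ≡⟨ sym (+-identityʳ (ℕtoℚ m)) ⟩
  ℕtoℚ m + 0ℚ                     ≤⟨ +-monoʳ-≤ (ℕtoℚ m) (ℕtoℚ-nonneg (n ℕ.∸ m)) ⟩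
  ℕtoℚ m + ℕtoℚ (n ℕ.∸ m)         ≡⟨ sym (ℕtoℚ-+ m (n ℕ.∸ m)) ⟩
  ℕtoℚ (m ℕ.+ (n ℕ.∸ m))          ≡⟨ cong ℕtoℚ (ℕ.m+[n∸m]≡n m≤n) ⟩
  ℕtoℚ n                          ∎
  where open ≤-Reasoning

ℕtoℚ-cancel-≤ : ∀ {m n} → ℕtoℚ m ≤ ℕtoℚ n → m ℕ.≤ n
ℕtoℚ-cancel-≤ {m} {n} m≤n = ℕ.≮⇒≥ n<m⇒⊥
  where
  n<m⇒⊥ : ¬ (n ℕ.< m)
  n<m⇒⊥ n<m = <-irrefl refl (begin-strict
    ℕtoℚ n            <⟨ subst (_< 1ℚ + ℕtoℚ n) (+-identityˡ (ℕtoℚ n)) (+-monoˡ-< (ℕtoℚ n) (positive⁻¹ 1ℚ)) ⟩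
    1ℚ + ℕtoℚ n       ≡⟨ sym (ℕtoℚ-suc n) ⟩
    ℕtoℚ (suc n)      ≤⟨ ℕtoℚ-mono-≤ n<m ⟩
    ℕtoℚ m            ≤⟨ m≤n ⟩
    ℕtoℚ n            ∎)
    where open ≤-Reasoning

ℕtoℚ-≤-2^ : ∀ k → ℕtoℚ k ≤ ℕtoℚ 2 ^ℚ k
ℕtoℚ-≤-2^ zero    = 0≤1
ℕtoℚ-≤-2^ (suc k) = begin
  ℕtoℚ (suc k)                        ≡⟨ ℕtoℚ-suc k ⟩
  1ℚ + ℕtoℚ k                         ≤⟨ +-mono-≤ (1≤^ k 1≤2) (ℕtoℚ-≤-2^ k) ⟩
  ℕtoℚ 2 ^ℚ k + ℕtoℚ 2 ^ℚ k           ≡⟨ p+p≡2*p (ℕtoℚ 2 ^ℚ k) ⟩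
  ℕtoℚ 2 * ℕtoℚ 2 ^ℚ k                ∎
  where
  open ≤-Reasoning
  p+p≡2*p : ∀ p → p + p ≡ ℕtoℚ 2 * p
  p+p≡2*p = solve 1 (λ p → p :+ p := con (ℕtoℚ 2) :* p) refl

-- Take N to be the denominator of x, so that N * x is its numerator.
archimedean : ∀ {x} → 0ℚ < x → ∃[ N ] (1ℚ ≤ ℕtoℚ N * x)
archimedean {x@(mkℚ ℤ.+[1+ k ] d-1 _)} 0<x = suc d-1 , toℚᵘ-cancel-≤ (begin
  ℚᵘ.mkℚᵘ (ℤ.+ 1) 0                             ≤⟨ ℚᵘ.*≤* (ℤ.+≤+ (ℕ.s≤s 1≤k+d*k)) ⟩
  ℚᵘ.mkℚᵘ (ℤ.+ suc d-1) 0 ℚᵘ.* toℚᵘ x            ≃⟨ ℚᵘ.*-congʳ (ℚᵘ.≃-sym (toℚᵘ-fromℚᵘ (ℚᵘ.mkℚᵘ (ℤ.+ suc d-1) 0))) ⟩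
  toℚᵘ (ℕtoℚ (suc d-1)) ℚᵘ.* toℚᵘ x              ≃⟨ ℚᵘ.≃-sym (toℚᵘ-homo-* (ℕtoℚ (suc d-1)) x) ⟩
  toℚᵘ (ℕtoℚ (suc d-1) * x)                      ∎)
  where
  open ℚᵘ.≤-Reasoning
  1≤k+d*k : d-1 ℕ.+ 0 ℕ.+ 0 ℕ.≤ (k ℕ.+ d-1 ℕ.* suc k) ℕ.* 1
  1≤k+d*k = ℕ.≤-trans (ℕ.≤-reflexive (trans (ℕ.+-identityʳ _) (ℕ.+-identityʳ d-1)))
              (ℕ.≤-trans (ℕ.m≤m*n d-1 (suc k)) (ℕ.≤-trans (ℕ.m≤n+m _ k) (ℕ.≤-reflexive (sym (ℕ.*-identityʳ _)))))
archimedean {mkℚ (ℤ.+ zero) _ _} (*<* (ℤ.+<+ ()))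
archimedean {mkℚ ℤ.-[1+ _ ] _ _} (*<* ())

bernoulli : ∀ {x} s → 0ℚ ≤ x → 1ℚ + ℕtoℚ s * x ≤ (1ℚ + x) ^ℚ s
bernoulli {x} zero    0≤x = ≤-reflexive (trans (cong (1ℚ +_) (*-zeroˡ x)) (+-identityʳ 1ℚ))
bernoulli {x} (suc s) 0≤x = begin
  1ℚ + ℕtoℚ (suc s) * x                         ≡⟨ cong (λ n → 1ℚ + n * x) (ℕtoℚ-suc s) ⟩
  1ℚ + (1ℚ + ℕtoℚ s) * x                        ≤⟨ p≤p+q (*-nonneg (*-nonneg (ℕtoℚ-nonneg s) 0≤x) 0≤x) ⟩
  1ℚ + (1ℚ + ℕtoℚ s) * x + ℕtoℚ s * x * x       ≡⟨ expand (ℕtoℚ s) x ⟩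
  (1ℚ + x) * (1ℚ + ℕtoℚ s * x)                  ≤⟨ *-monoˡ-≤-nonneg (1ℚ + x) (+-nonneg 0≤1 0≤x) (bernoulli s 0≤x) ⟩
  (1ℚ + x) * (1ℚ + x) ^ℚ s                      ∎
  where
  open ≤-Reasoning
  p≤p+q : ∀ {p q} → 0ℚ ≤ q → p ≤ p + q
  p≤p+q {p} 0≤q = subst (_≤ p + _) (+-identityʳ p) (+-monoʳ-≤ p 0≤q)
  expand : ∀ s x → 1ℚ + (1ℚ + s) * x + s * x * x ≡ (1ℚ + x) * (1ℚ + s * x)
  expand = solve 2 (λ s x → con 1ℚ :+ (con 1ℚ :+ s) :* x :+ s :* x :* x := (con 1ℚ :+ x) :* (con 1ℚ :+ s :* x)) refl

[1-x]^s≤½ : ∀ {x} s → 0ℚ ≤ x → x ≤ 1ℚ → 1ℚ ≤ ℕtoℚ s * x → (1ℚ - x) ^ℚ s ≤ ½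
[1-x]^s≤½ {x} s 0≤x x≤1 1≤sx = *-cancelʳ-≤-pos (1ℚ + 1ℚ) (begin
  y * (1ℚ + 1ℚ)                     ≤⟨ *-monoˡ-≤-nonneg y 0≤y (+-monoʳ-≤ 1ℚ 1≤sx) ⟩
  y * (1ℚ + ℕtoℚ s * x)             ≤⟨ *-monoˡ-≤-nonneg y 0≤y (bernoulli s 0≤x) ⟩
  y * (1ℚ + x) ^ℚ s                 ≡⟨ sym (^-distrib-* (1ℚ - x) (1ℚ + x) s) ⟩
  ((1ℚ - x) * (1ℚ + x)) ^ℚ s        ≤⟨ ^≤1 s (*-nonneg 0≤1-x (+-nonneg 0≤1 0≤x)) [1-x][1+x]≤1 ⟩
  1ℚ                                ≡⟨⟩
  ½ * (1ℚ + 1ℚ)                     ∎)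
  where
  open ≤-Reasoning
  y : ℚ
  y = (1ℚ - x) ^ℚ s
  0≤1-x : 0ℚ ≤ 1ℚ - x
  0≤1-x = p≤q⇒0≤q-p x≤1
  0≤y : 0ℚ ≤ y
  0≤y = ^-nonneg s 0≤1-x
  difference-of-squares : ∀ x → (1ℚ - x) * (1ℚ + x) ≡ 1ℚ - x * x
  difference-of-squares = solve 1 (λ x → (con 1ℚ :- x) :* (con 1ℚ :+ x) := con 1ℚ :- x :* x) refl
  [1-x][1+x]≤1 : (1ℚ - x) * (1ℚ + x) ≤ 1ℚ
  [1-x][1+x]≤1 = begin
    (1ℚ - x) * (1ℚ + x)     ≡⟨ difference-of-squares x ⟩
    1ℚ - x * x              ≤⟨ +-monoʳ-≤ 1ℚ (neg-antimono-≤ (*-nonneg 0≤x 0≤x)) ⟩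
    1ℚ - 0ℚ                 ≡⟨⟩
    1ℚ                      ∎

½^j≤δ : ∀ {δ} j → 1ℚ ≤ δ * ℕtoℚ 2 ^ℚ j → ½ ^ℚ j ≤ δ
½^j≤δ {δ} j 1≤δ2^j = begin
  ½ ^ℚ j                              ≡⟨ sym (*-identityʳ _) ⟩
  ½ ^ℚ j * 1ℚ                         ≤⟨ *-monoˡ-≤-nonneg (½ ^ℚ j) (^-nonneg j (nonNegative⁻¹ ½)) 1≤δ2^j ⟩
  ½ ^ℚ j * (δ * ℕtoℚ 2 ^ℚ j)          ≡⟨ rearrange (½ ^ℚ j) δ (ℕtoℚ 2 ^ℚ j) ⟩
  δ * (½ ^ℚ j * ℕtoℚ 2 ^ℚ j)          ≡⟨ cong (δ *_) (sym (^-distrib-* ½ (ℕtoℚ 2) j)) ⟩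
  δ * 1ℚ ^ℚ j                         ≡⟨ cong (δ *_) (1^ j) ⟩
  δ * 1ℚ                              ≡⟨ *-identityʳ δ ⟩
  δ                                   ∎
  where
  open ≤-Reasoning
  rearrange : ∀ a b c → a * (b * c) ≡ b * (a * c)
  rearrange = solve 3 (λ a b c → a :* (b :* c) := b :* (a :* c)) refl

[s*l]^m≤s^i*l^j : ∀ {s l} {m} i j → 0ℚ ≤ s → s ≤ l → i ℕ.≤ j → i ℕ.+ j ≡ m ℕ.+ m →
                  (s * l) ^ℚ m ≤ s ^ℚ i * l ^ℚ j
[s*l]^m≤s^i*l^j {s} {l} {m} i j 0≤s s≤l i≤j i+j≡m+m =
  subst₂ (λ m′ j′ → (s * l) ^ℚ m′ ≤ s ^ℚ i * l ^ℚ j′) i+d≡m (sym j≡i+2d) (split-bound d)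
  where
  i≤m : i ℕ.≤ m
  i≤m = ℕ.≮⇒≥ (λ m<i → ℕ.<-irrefl (sym i+j≡m+m) (ℕ.+-mono-< m<i (ℕ.<-≤-trans m<i i≤j)))
  d : ℕ
  d = m ℕ.∸ i
  i+d≡m : i ℕ.+ d ≡ m
  i+d≡m = ℕ.m+[n∸m]≡n i≤m
  regroup : ∀ i d → (i ℕ.+ d) ℕ.+ (i ℕ.+ d) ≡ i ℕ.+ (i ℕ.+ (d ℕ.+ d))
  regroup = solve-∀
  j≡i+2d : j ≡ i ℕ.+ (d ℕ.+ d)
  j≡i+2d = ℕ.+-cancelˡ-≡ i j _ (trans i+j≡m+m (trans (cong (λ k → k ℕ.+ k) (sym i+d≡m)) (regroup i d)))
  0≤l : 0ℚ ≤ l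
  0≤l = ≤-trans 0≤s s≤l
  split-bound : ∀ d → (s * l) ^ℚ (i ℕ.+ d) ≤ s ^ℚ i * l ^ℚ (i ℕ.+ (d ℕ.+ d))
  split-bound d = begin
    (s * l) ^ℚ (i ℕ.+ d)                       ≡⟨ ^-+ (s * l) i d ⟩
    (s * l) ^ℚ i * (s * l) ^ℚ d                ≡⟨ cong (_* (s * l) ^ℚ d) (^-distrib-* s l i) ⟩
    (s ^ℚ i * l ^ℚ i) * (s * l) ^ℚ d           ≤⟨ *-monoˡ-≤-nonneg (s ^ℚ i * l ^ℚ i) (*-nonneg (^-nonneg i 0≤s) (^-nonneg i 0≤l))
                                                    (^-monoˡ-≤ d (*-nonneg 0≤s 0≤l) (*-monoʳ-≤-nonneg l 0≤l s≤l)) ⟩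
    (s ^ℚ i * l ^ℚ i) * (l * l) ^ℚ d           ≡⟨ cong ((s ^ℚ i * l ^ℚ i) *_) (trans (^-distrib-* l l d) (sym (^-+ l d d))) ⟩
    (s ^ℚ i * l ^ℚ i) * l ^ℚ (d ℕ.+ d)         ≡⟨ *-assoc (s ^ℚ i) (l ^ℚ i) _ ⟩
    s ^ℚ i * (l ^ℚ i * l ^ℚ (d ℕ.+ d))         ≡⟨ cong (s ^ℚ i *_) (sym (^-+ l i (d ℕ.+ d))) ⟩
    s ^ℚ i * l ^ℚ (i ℕ.+ (d ℕ.+ d))            ∎
    where open ≤-Reasoning

IsLeast : (ℕ → Set) → ℕ → Set
IsLeast P j = P j × (∀ k → P k → j ℕ.≤ k)

least-satisfying : ∀ {P : ℕ → Set} → Decidable P → ∀ N → P N → ∃[ j ] IsLeast P j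
least-satisfying {P} P? N = <-rec (λ N → P N → ∃[ j ] IsLeast P j) search N
  where
  search : ∀ N → (∀ {n} → n ℕ.< N → P n → ∃[ j ] IsLeast P j) → P N → ∃[ j ] IsLeast P j
  search N below pN with ℕ.anyUpTo? P? N
  ... | yes (n , n<N , pn) = below n<N pn
  ... | no  ∄n<N           = N , pN , λ k pk → ℕ.≮⇒≥ (λ k<N → ∄n<N (k , k<N , pk))

multiple-between-1-and-2 : ∀ {x} → 0ℚ < x → x ≤ 1ℚ → ∃[ s ] (1ℚ ≤ ℕtoℚ s * x × ℕtoℚ s * x ≤ 1ℚ + 1ℚ)
multiple-between-1-and-2 {x} 0<x x≤1 with archimedean 0<x
... | N , 1≤Nx with least-satisfying (λ s → 1ℚ ≤? ℕtoℚ s * x) N 1≤Nx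
...   | zero  , 1≤0  , _       = ⊥-elim (<-irrefl refl (<-≤-trans (positive⁻¹ 1ℚ) (subst (1ℚ ≤_) (*-zeroˡ x) 1≤0)))
...   | suc s , 1≤sx , minimal = suc s , 1≤sx , (begin
  ℕtoℚ (suc s) * x              ≡⟨ cong (_* x) (ℕtoℚ-suc s) ⟩
  (1ℚ + ℕtoℚ s) * x             ≡⟨ trans (*-distribʳ-+ x 1ℚ (ℕtoℚ s)) (cong (_+ ℕtoℚ s * x) (*-identityˡ x)) ⟩
  x + ℕtoℚ s * x                ≤⟨ +-mono-≤ x≤1 (<⇒≤ (≰⇒> (λ 1≤s′x → ℕ.<-irrefl refl (minimal s 1≤s′x)))) ⟩
  1ℚ + 1ℚ                       ∎)
  where open ≤-Reasoning

least-doubling-exponent : ∀ {δ} → 0ℚ < δ → ∃[ j ] IsLeast (λ j → 1ℚ ≤ δ * ℕtoℚ 2 ^ℚ j) j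
least-doubling-exponent {δ} 0<δ with archimedean 0<δ
... | N , 1≤Nδ = least-satisfying (λ k → 1ℚ ≤? δ * ℕtoℚ 2 ^ℚ k) N (begin
  1ℚ                     ≤⟨ 1≤Nδ ⟩
  ℕtoℚ N * δ             ≤⟨ *-monoʳ-≤-nonneg δ (<⇒≤ 0<δ) (ℕtoℚ-≤-2^ N) ⟩
  ℕtoℚ 2 ^ℚ N * δ        ≡⟨ *-comm _ δ ⟩
  δ * ℕtoℚ 2 ^ℚ N        ∎)
  where open ≤-Reasoning

1-ε≤p⇒q≤ε : ∀ {p q ε} → p + q ≡ 1ℚ → 1ℚ - ε ≤ p → q ≤ ε
1-ε≤p⇒q≤ε {p} {q} {ε} p+q≡1 1-ε≤p = begin
  q                ≡⟨ q≡[p+q]-p p q ⟩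
  (p + q) - p      ≡⟨ cong (_- p) p+q≡1 ⟩
  1ℚ - p           ≤⟨ +-monoʳ-≤ 1ℚ (neg-antimono-≤ 1-ε≤p) ⟩
  1ℚ - (1ℚ - ε)    ≡⟨ 1-[1-ε]≡ε ε ⟩
  ε                ∎
  where
  open ≤-Reasoning
  q≡[p+q]-p : ∀ p q → q ≡ (p + q) - p
  q≡[p+q]-p = solve 2 (λ p q → q := (p :+ q) :- p) refl
  1-[1-ε]≡ε : ∀ ε → 1ℚ - (1ℚ - ε) ≡ ε
  1-[1-ε]≡ε = solve 1 (λ ε → con 1ℚ :- (con 1ℚ :- ε) := ε) refl

q≤δ⇒1-δ≤p : ∀ {p q δ} → p + q ≡ 1ℚ → q ≤ δ → 1ℚ - δ ≤ p
q≤δ⇒1-δ≤p {p} {q} {δ} p+q≡1 q≤δ = begin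
  1ℚ - δ           ≤⟨ +-monoʳ-≤ 1ℚ (neg-antimono-≤ q≤δ) ⟩
  1ℚ - q           ≡⟨ cong (_- q) (sym p+q≡1) ⟩
  (p + q) - q      ≡⟨ [p+q]-q≡p p q ⟩
  p                ∎
  where
  open ≤-Reasoning
  [p+q]-q≡p : ∀ p q → (p + q) - q ≡ p
  [p+q]-q≡p = solve 2 (λ p q → (p :+ q) :- q := p) refl

ε≤½⇒0≤1-2ε : ∀ {ε} → ε ≤ ½ → 0ℚ ≤ 1ℚ - (ε + ε)
ε≤½⇒0≤1-2ε {ε} ε≤½ = subst (0ℚ ≤_) (sym (halves ε)) (+-nonneg (p≤q⇒0≤q-p ε≤½) (p≤q⇒0≤q-p ε≤½))
  where
  halves : ∀ ε → 1ℚ - (ε + ε) ≡ (½ - ε) + (½ - ε)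
  halves = solve 1 (λ ε → con 1ℚ :- (ε :+ ε) := (con ½ :- ε) :+ (con ½ :- ε)) refl

ε≤½⇒ε≤1-ε : ∀ {ε} → ε ≤ ½ → ε ≤ 1ℚ - ε
ε≤½⇒ε≤1-ε {ε} ε≤½ = 0≤q-p⇒p≤q (subst (0ℚ ≤_) (1-2ε≡[1-ε]-ε ε) (ε≤½⇒0≤1-2ε ε≤½))
  where
  1-2ε≡[1-ε]-ε : ∀ ε → 1ℚ - (ε + ε) ≡ (1ℚ - ε) - ε
  1-2ε≡[1-ε]-ε = solve 1 (λ ε → con 1ℚ :- (ε :+ ε) := (con 1ℚ :- ε) :- ε) refl

-- With c = 1 - r the mixture is ε + (1 - 2ε) r, increasing in r.
mixture-≤ : ∀ {ε c r} → ε ≤ ½ → c + r ≡ 1ℚ → r ≤ ε → ε * c + (1ℚ - ε) * r ≤ ε * (1ℚ - ε) + ε * (1ℚ - ε)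
mixture-≤ {ε} {c} {r} ε≤½ c+r≡1 r≤ε = begin
  ε * c + (1ℚ - ε) * r                   ≡⟨ regroup ε c r ⟩
  ε * (c + r) + (1ℚ - (ε + ε)) * r       ≡⟨ cong (λ s → ε * s + (1ℚ - (ε + ε)) * r) c+r≡1 ⟩
  ε * 1ℚ + (1ℚ - (ε + ε)) * r            ≤⟨ +-monoʳ-≤ (ε * 1ℚ) (*-monoˡ-≤-nonneg (1ℚ - (ε + ε)) (ε≤½⇒0≤1-2ε ε≤½) r≤ε) ⟩
  ε * 1ℚ + (1ℚ - (ε + ε)) * ε            ≡⟨ collect ε ⟩
  ε * (1ℚ - ε) + ε * (1ℚ - ε)            ∎
  where
  open ≤-Reasoning
  regroup : ∀ ε c r → ε * c + (1ℚ - ε) * r ≡ ε * (c + r) + (1ℚ - (ε + ε)) * r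
  regroup = solve 3 (λ ε c r → ε :* c :+ (con 1ℚ :- ε) :* r := ε :* (c :+ r) :+ (con 1ℚ :- (ε :+ ε)) :* r) refl
  collect : ∀ ε → ε * 1ℚ + (1ℚ - (ε + ε)) * ε ≡ ε * (1ℚ - ε) + ε * (1ℚ - ε)
  collect = solve 1 (λ ε → ε :* con 1ℚ :+ (con 1ℚ :- (ε :+ ε)) :* ε := ε :* (con 1ℚ :- ε) :+ ε :* (con 1ℚ :- ε)) refl

amplification-exponent-≤ : ∀ {g} s j k a b → 0ℚ < g → ℕtoℚ s * (ℕtoℚ 4 * g) ≤ 1ℚ + 1ℚ → j ℕ.≤ k →
                           ℕtoℚ 1 * ℕtoℚ k * ℕtoℚ (suc b) ≤ ℕtoℚ a * g →
                           suc b ℕ.* (j ℕ.* s ℕ.+ j ℕ.* s) ℕ.≤ a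
amplification-exponent-≤ {g} s j k a b 0<g s4g≤2 j≤k k[b+1]≤ag =
  ℕtoℚ-cancel-≤ (*-cancelʳ-≤-pos (g + g) {{positive (+-mono-< 0<g 0<g)}} (begin
    ℕtoℚ (suc b ℕ.* (j ℕ.* s ℕ.+ j ℕ.* s)) * (g + g)
      ≡⟨ cong (_* (g + g)) (trans (ℕtoℚ-* (suc b) (j ℕ.* s ℕ.+ j ℕ.* s))
                                  (cong (B *_) (trans (ℕtoℚ-+ (j ℕ.* s) (j ℕ.* s)) (cong₂ _+_ (ℕtoℚ-* j s) (ℕtoℚ-* j s))))) ⟩
    B * (J * S + J * S) * (g + g)
      ≡⟨ regroup B J S g ⟩
    (J * B) * (S * (ℕtoℚ 4 * g))
      ≤⟨ *-monoˡ-≤-nonneg (J * B) (*-nonneg (ℕtoℚ-nonneg j) (ℕtoℚ-nonneg (suc b))) s4g≤2 ⟩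
    (J * B) * (1ℚ + 1ℚ)
      ≤⟨ *-monoʳ-≤-nonneg (1ℚ + 1ℚ) (≤ᵇ⇒≤ tt) (*-monoʳ-≤-nonneg B (ℕtoℚ-nonneg (suc b)) (ℕtoℚ-mono-≤ j≤k)) ⟩
    (ℕtoℚ k * B) * (1ℚ + 1ℚ)
      ≡⟨ double (ℕtoℚ k) B ⟩
    ℕtoℚ 1 * ℕtoℚ k * B + ℕtoℚ 1 * ℕtoℚ k * B
      ≤⟨ +-mono-≤ k[b+1]≤ag k[b+1]≤ag ⟩
    ℕtoℚ a * g + ℕtoℚ a * g
      ≡⟨ sym (*-distribˡ-+ (ℕtoℚ a) g g) ⟩
    ℕtoℚ a * (g + g) ∎))
  where
  open ≤-Reasoning
  B J S : ℚ
  B = ℕtoℚ (suc b)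
  J = ℕtoℚ j
  S = ℕtoℚ s
  regroup : ∀ B J S g → B * (J * S + J * S) * (g + g) ≡ (J * B) * (S * (ℕtoℚ 4 * g))
  regroup = solve 4 (λ B J S g → B :* (J :* S :+ J :* S) :* (g :+ g) := (J :* B) :* (S :* (con (ℕtoℚ 4) :* g))) refl
  double : ∀ K B → (K * B) * (1ℚ + 1ℚ) ≡ ℕtoℚ 1 * K * B + ℕtoℚ 1 * K * B
  double = solve 2 (λ K B → (K :* B) :* (con 1ℚ :+ con 1ℚ) := con (ℕtoℚ 1) :* K :* B :+ con (ℕtoℚ 1) :* K :* B) refl

4ε[1-ε]≡1-4[½-ε]² : ∀ ε → ℕtoℚ 4 * (ε * (1ℚ - ε)) ≡ 1ℚ - ℕtoℚ 4 * ((½ - ε) * (½ - ε))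
4ε[1-ε]≡1-4[½-ε]² = solve 1 (λ ε → con (ℕtoℚ 4) :* (ε :* (con 1ℚ :- ε))
                                   := con 1ℚ :- con (ℕtoℚ 4) :* ((con ½ :- ε) :* (con ½ :- ε))) refl

4[½-ε]²≤1 : ∀ {ε} → 0ℚ ≤ ε → ε ≤ ½ → ℕtoℚ 4 * ((½ - ε) * (½ - ε)) ≤ 1ℚ
4[½-ε]²≤1 {ε} 0≤ε ε≤½ = 0≤q-p⇒p≤q (subst (0ℚ ≤_) (4ε[1-ε]≡1-4[½-ε]² ε)
                          (*-nonneg (ℕtoℚ-nonneg 4) (*-nonneg 0≤ε (≤-trans 0≤ε (ε≤½⇒ε≤1-ε ε≤½)))))

[4ε[1-ε]]^[j*s]≤δ : ∀ {ε δ} s j → 0ℚ ≤ ε → ε ≤ ½ →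
                    1ℚ ≤ ℕtoℚ s * (ℕtoℚ 4 * ((½ - ε) * (½ - ε))) → 1ℚ ≤ δ * ℕtoℚ 2 ^ℚ j →
                    (ℕtoℚ 4 * (ε * (1ℚ - ε))) ^ℚ (j ℕ.* s) ≤ δ
[4ε[1-ε]]^[j*s]≤δ {ε} {δ} s j 0≤ε ε≤½ 1≤s4g 1≤δ2^j = begin
  (ℕtoℚ 4 * (ε * (1ℚ - ε))) ^ℚ (j ℕ.* s)     ≡⟨ ^-* _ j s ⟩
  ((ℕtoℚ 4 * (ε * (1ℚ - ε))) ^ℚ s) ^ℚ j      ≡⟨ cong (λ q → (q ^ℚ s) ^ℚ j) (4ε[1-ε]≡1-4[½-ε]² ε) ⟩
  ((1ℚ - x) ^ℚ s) ^ℚ j                       ≤⟨ ^-monoˡ-≤ j (^-nonneg s (p≤q⇒0≤q-p x≤1)) ([1-x]^s≤½ s 0≤x x≤1 1≤s4g) ⟩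
  ½ ^ℚ j                                     ≤⟨ ½^j≤δ j 1≤δ2^j ⟩
  δ                                          ∎
  where
  open ≤-Reasoning
  x : ℚ
  x = ℕtoℚ 4 * ((½ - ε) * (½ - ε))
  x≤1 : x ≤ 1ℚ
  x≤1 = 4[½-ε]²≤1 0≤ε ε≤½
  0≤x : 0ℚ ≤ x
  0≤x = *-nonneg (ℕtoℚ-nonneg 4) (*-nonneg (p≤q⇒0≤q-p ε≤½) (p≤q⇒0≤q-p ε≤½))

∑ : {A : Set} → List A → (A → ℚ) → ℚ
∑ xs g = sumℚ (map g xs)

module _ {A : Set} where

  ∑-++ : ∀ (xs ys : List A) g → ∑ (xs ++ ys) g ≡ ∑ xs g + ∑ ys g
  ∑-++ []       ys g = sym (+-identityˡ _)
  ∑-++ (x ∷ xs) ys g = trans (cong (g x +_) (∑-++ xs ys g)) (sym (+-assoc (g x) _ _))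

  ∑-cong : ∀ (xs : List A) {g h} → (∀ x → g x ≡ h x) → ∑ xs g ≡ ∑ xs h
  ∑-cong []       g≗h = refl
  ∑-cong (x ∷ xs) g≗h = cong₂ _+_ (g≗h x) (∑-cong xs g≗h)

  ∑-0 : ∀ (xs : List A) → ∑ xs (λ _ → 0ℚ) ≡ 0ℚ
  ∑-0 []       = refl
  ∑-0 (x ∷ xs) = trans (+-identityˡ _) (∑-0 xs)

  ∑-+ : ∀ (xs : List A) g h → ∑ xs (λ x → g x + h x) ≡ ∑ xs g + ∑ xs h
  ∑-+ []       g h = refl
  ∑-+ (x ∷ xs) g h = trans (cong (g x + h x +_) (∑-+ xs g h)) (interchange (g x) (h x) _ _)
    where
    interchange : ∀ a b c d → (a + b) + (c + d) ≡ (a + c) + (b + d)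
    interchange = solve 4 (λ a b c d → (a :+ b) :+ (c :+ d) := (a :+ c) :+ (b :+ d)) refl

  ∑-*ˡ : ∀ (xs : List A) c g → ∑ xs (λ x → c * g x) ≡ c * ∑ xs g
  ∑-*ˡ []       c g = sym (*-zeroʳ c)
  ∑-*ˡ (x ∷ xs) c g = trans (cong (c * g x +_) (∑-*ˡ xs c g)) (sym (*-distribˡ-+ c _ _))

  ∑-*ʳ : ∀ (xs : List A) c g → ∑ xs (λ x → g x * c) ≡ ∑ xs g * c
  ∑-*ʳ xs c g = trans (∑-cong xs (λ x → *-comm (g x) c)) (trans (∑-*ˡ xs c g) (*-comm c _))

  ∑-mono-≤ : ∀ {xs : List A} {g h} → All (λ x → g x ≤ h x) xs → ∑ xs g ≤ ∑ xs h
  ∑-mono-≤ []           = ≤-refl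
  ∑-mono-≤ (gx≤hx ∷ ps) = +-mono-≤ gx≤hx (∑-mono-≤ ps)

  ∑-nonneg : ∀ {xs : List A} {g} → All (λ x → 0ℚ ≤ g x) xs → 0ℚ ≤ ∑ xs g
  ∑-nonneg {xs} ps = subst (_≤ ∑ xs _) (∑-0 xs) (∑-mono-≤ ps)

∑-concatMap : ∀ {A B : Set} (F : A → List B) xs g → ∑ (concatMap F xs) g ≡ ∑ xs (λ x → ∑ (F x) g)
∑-concatMap F []       g = refl
∑-concatMap F (x ∷ xs) g = trans (∑-++ (F x) (concatMap F xs) g) (cong (∑ (F x) g +_) (∑-concatMap F xs g))

All-concatMap⁺ : ∀ {A B : Set} {P : B → Set} (F : A → List B) {xs} → All (λ x → All P (F x)) xs → All P (concatMap F xs)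
All-concatMap⁺ F ps = concat⁺ (map⁺ {f = F} ps)

∑-comm : ∀ {A B : Set} (xs : List A) (ys : List B) (h : A → B → ℚ) →
         ∑ xs (λ x → ∑ ys (h x)) ≡ ∑ ys (λ y → ∑ xs (λ x → h x y))
∑-comm []       ys h = sym (∑-0 ys)
∑-comm (x ∷ xs) ys h = trans (cong (∑ ys (h x) +_) (∑-comm xs ys h)) (sym (∑-+ ys (h x) _))

∑-∑-* : ∀ {A B : Set} (xs : List A) (ys : List B) (g : A → ℚ) (h : B → ℚ) →
        ∑ xs (λ x → ∑ ys (λ y → g x * h y)) ≡ ∑ xs g * ∑ ys h
∑-∑-* xs ys g h = trans (∑-cong xs (λ x → ∑-*ˡ ys (g x) h)) (∑-*ʳ xs (∑ ys h) g)

[_]·_ : Bool → ℚ → ℚ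
[ b ]· q = if b then q else 0ℚ

[]·-nonneg : ∀ b {q} → 0ℚ ≤ q → 0ℚ ≤ [ b ]· q
[]·-nonneg true  0≤q = 0≤q
[]·-nonneg false 0≤q = ≤-refl

[]·-+ : ∀ b p q → [ b ]· (p + q) ≡ [ b ]· p + [ b ]· q
[]·-+ true  p q = refl
[]·-+ false p q = refl

[]·-*ʳ : ∀ b p q → ([ b ]· p) * q ≡ [ b ]· (p * q)
[]·-*ʳ true  p q = refl
[]·-*ʳ false p q = *-zeroˡ q

[]·-*-[]· : ∀ a b p q → ([ a ]· p) * ([ b ]· q) ≡ [ a ∧ b ]· (p * q)
[]·-*-[]· true  true  p q = refl
[]·-*-[]· true  false p q = *-zeroʳ p
[]·-*-[]· false b     p q = *-zeroˡ ([ b ]· q)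

[]·-comm : ∀ b c q → [ b ]· [ c ]· q ≡ [ c ]· [ b ]· q
[]·-comm true  c     q = refl
[]·-comm false true  q = refl
[]·-comm false false q = refl

[]·-∑ : ∀ {A : Set} b (xs : List A) g → [ b ]· ∑ xs g ≡ ∑ xs (λ x → [ b ]· g x)
[]·-∑ true  xs g = refl
[]·-∑ false xs g = sym (∑-0 xs)

-- Subcubes

_==ₛ_ : Sym → Sym → Bool
fix a ==ₛ fix b = a ==B b
⋆     ==ₛ ⋆     = true
_     ==ₛ _     = false

_==ˢ_ : ∀ {n} → Support n → Support n → Bool
[]      ==ˢ []      = true
(a ∷ s) ==ˢ (b ∷ t) = (a ==ₛ b) ∧ (s ==ˢ t)

-- Holds because allSupports lists every support exactly once.
∑-allSupports-==ˢ : ∀ n (B : Support n) h → ∑ (allSupports n) (λ A → [ B ==ˢ A ]· h A) ≡ h B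
∑-allSupports-==ˢ zero    []      h = +-identityʳ (h [])
∑-allSupports-==ˢ (suc n) (c ∷ B) h = begin
  ∑ (allSupports (suc n)) (λ A → [ (c ∷ B) ==ˢ A ]· h A)
    ≡⟨ ∑-concatMap (λ s → (fix false ∷ s) ∷ (fix true ∷ s) ∷ (⋆ ∷ s) ∷ []) (allSupports n) _ ⟩
  ∑ (allSupports n) (λ s → ∑ ((fix false ∷ s) ∷ (fix true ∷ s) ∷ (⋆ ∷ s) ∷ []) (λ A → [ (c ∷ B) ==ˢ A ]· h A))
    ≡⟨ ∑-cong (allSupports n) (one-extension c) ⟩
  ∑ (allSupports n) (λ s → [ B ==ˢ s ]· h (c ∷ s))
    ≡⟨ ∑-allSupports-==ˢ n B (λ s → h (c ∷ s)) ⟩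
  h (c ∷ B) ∎
  where
  open ≡-Reasoning
  one-extension : ∀ c s → ∑ ((fix false ∷ s) ∷ (fix true ∷ s) ∷ (⋆ ∷ s) ∷ []) (λ A → [ (c ∷ B) ==ˢ A ]· h A)
                        ≡ [ B ==ˢ s ]· h (c ∷ s)
  one-extension (fix false) s = +-identityʳ _
  one-extension (fix true)  s = trans (+-identityˡ _) (+-identityʳ _)
  one-extension ⋆           s = trans (+-identityˡ _) (trans (+-identityˡ _) (+-identityʳ _))

_∈ₛ_ : Bool → Sym → Bool
b ∈ₛ fix c = b ==B c
b ∈ₛ ⋆     = true

dimₛ : Sym → ℕ
dimₛ (fix _) = 1
dimₛ ⋆       = 0

_⊓_ : Sym → Sym → Maybe Sym
fix a ⊓ fix b = if a ==B b then just (fix a) else nothing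
fix a ⊓ ⋆     = just (fix a)
⋆     ⊓ b     = just b

_∩_ : ∀ {n} → Support n → Support n → Maybe (Support n)
[]      ∩ []      = just []
(a ∷ s) ∩ (b ∷ t) = zipWith _∷_ (a ⊓ b) (s ∩ t)

_∈ᴹ_ : ∀ {n} → Cube n → Maybe (Support n) → Bool
x ∈ᴹ C = maybe′ (x ∈C_) false C

dimᴹ : ∀ {n} → Maybe (Support n) → ℕ
dimᴹ C = maybe′ dim 0 C

∈C-∷ : ∀ {n} b (x : Cube n) a s → (b ∷ x) ∈C (a ∷ s) ≡ (b ∈ₛ a) ∧ (x ∈C s)
∈C-∷ b x (fix c) s = refl
∈C-∷ b x ⋆       s = refl

dim-∷ : ∀ {n} a (s : Support n) → dim (a ∷ s) ≡ dimₛ a ℕ.+ dim s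
dim-∷ (fix _) s = refl
dim-∷ ⋆       s = refl

∈ᴹ-zipWith-∷ : ∀ {n} b (x : Cube n) mc ms →
               (b ∷ x) ∈ᴹ zipWith _∷_ mc ms ≡ maybe′ (b ∈ₛ_) false mc ∧ (x ∈ᴹ ms)
∈ᴹ-zipWith-∷ b x nothing  ms       = refl
∈ᴹ-zipWith-∷ b x (just c) nothing  = sym (∧-zeroʳ (b ∈ₛ c))
∈ᴹ-zipWith-∷ b x (just c) (just s) = ∈C-∷ b x c s

dimᴹ-zipWith-∷ : ∀ {n} mc (ms : Maybe (Support n)) → dimᴹ (zipWith _∷_ mc ms) ℕ.≤ maybe′ dimₛ 0 mc ℕ.+ dimᴹ ms
dimᴹ-zipWith-∷ nothing  ms       = ℕ.z≤n
dimᴹ-zipWith-∷ (just c) nothing  = ℕ.z≤n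
dimᴹ-zipWith-∷ (just c) (just s) = ℕ.≤-reflexive (dim-∷ c s)

∈-⊓ : ∀ b a a′ → maybe′ (b ∈ₛ_) false (a ⊓ a′) ≡ (b ∈ₛ a) ∧ (b ∈ₛ a′)
∈-⊓ b     ⋆           a′          = refl
∈-⊓ b     (fix c)     ⋆           = sym (∧-identityʳ _)
∈-⊓ false (fix false) (fix false) = refl
∈-⊓ false (fix false) (fix true)  = refl
∈-⊓ false (fix true)  (fix false) = refl
∈-⊓ false (fix true)  (fix true)  = refl
∈-⊓ true  (fix false) (fix false) = refl
∈-⊓ true  (fix false) (fix true)  = refl
∈-⊓ true  (fix true)  (fix false) = refl
∈-⊓ true  (fix true)  (fix true)  = refl

dim-⊓ : ∀ a a′ → maybe′ dimₛ 0 (a ⊓ a′) ℕ.≤ dimₛ a ℕ.+ dimₛ a′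
dim-⊓ ⋆           ⋆           = ℕ.z≤n
dim-⊓ ⋆           (fix _)     = ℕ.≤-refl
dim-⊓ (fix _)     ⋆           = ℕ.s≤s ℕ.z≤n
dim-⊓ (fix false) (fix false) = ℕ.s≤s ℕ.z≤n
dim-⊓ (fix false) (fix true)  = ℕ.z≤n
dim-⊓ (fix true)  (fix false) = ℕ.z≤n
dim-⊓ (fix true)  (fix true)  = ℕ.s≤s ℕ.z≤n

∈-∩ : ∀ {n} (x : Cube n) A B → x ∈ᴹ (A ∩ B) ≡ (x ∈C A) ∧ (x ∈C B)
∈-∩ []      []      []      = refl
∈-∩ (b ∷ x) (a ∷ s) (a′ ∷ t) = begin
  (b ∷ x) ∈ᴹ zipWith _∷_ (a ⊓ a′) (s ∩ t)                  ≡⟨ ∈ᴹ-zipWith-∷ b x (a ⊓ a′) (s ∩ t) ⟩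
  maybe′ (b ∈ₛ_) false (a ⊓ a′) ∧ (x ∈ᴹ (s ∩ t))           ≡⟨ cong₂ _∧_ (∈-⊓ b a a′) (∈-∩ x s t) ⟩
  ((b ∈ₛ a) ∧ (b ∈ₛ a′)) ∧ ((x ∈C s) ∧ (x ∈C t))          ≡⟨ ∧-interchange (b ∈ₛ a) (b ∈ₛ a′) (x ∈C s) (x ∈C t) ⟩
  ((b ∈ₛ a) ∧ (x ∈C s)) ∧ ((b ∈ₛ a′) ∧ (x ∈C t))          ≡⟨ sym (cong₂ _∧_ (∈C-∷ b x a s) (∈C-∷ b x a′ t)) ⟩
  ((b ∷ x) ∈C (a ∷ s)) ∧ ((b ∷ x) ∈C (a′ ∷ t))            ∎
  where
  open ≡-Reasoning
  ∧-interchange : ∀ p q r s → (p ∧ q) ∧ (r ∧ s) ≡ (p ∧ r) ∧ (q ∧ s)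
  ∧-interchange false q     r s = refl
  ∧-interchange true  false false s = refl
  ∧-interchange true  false true  s = refl
  ∧-interchange true  true  r s = refl

dim-∩ : ∀ {n} (A B : Support n) → dimᴹ (A ∩ B) ℕ.≤ dim A ℕ.+ dim B
dim-∩ []      []       = ℕ.z≤n
dim-∩ (a ∷ s) (a′ ∷ t) = begin
  dimᴹ (zipWith _∷_ (a ⊓ a′) (s ∩ t))                  ≤⟨ dimᴹ-zipWith-∷ (a ⊓ a′) (s ∩ t) ⟩
  maybe′ dimₛ 0 (a ⊓ a′) ℕ.+ dimᴹ (s ∩ t)               ≤⟨ ℕ.+-mono-≤ (dim-⊓ a a′) (dim-∩ s t) ⟩
  (dimₛ a ℕ.+ dimₛ a′) ℕ.+ (dim s ℕ.+ dim t)           ≡⟨ interchange (dimₛ a) (dimₛ a′) (dim s) (dim t) ⟩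
  (dimₛ a ℕ.+ dim s) ℕ.+ (dimₛ a′ ℕ.+ dim t)           ≡⟨ sym (cong₂ ℕ._+_ (dim-∷ a s) (dim-∷ a′ t)) ⟩
  dim (a ∷ s) ℕ.+ dim (a′ ∷ t)                         ∎
  where
  open ℕ.≤-Reasoning
  interchange : ∀ p q r s → (p ℕ.+ q) ℕ.+ (r ℕ.+ s) ≡ (p ℕ.+ r) ℕ.+ (q ℕ.+ s)
  interchange = solve-∀

∈-replicate-⋆ : ∀ {n} (x : Cube n) → x ∈C replicate n ⋆ ≡ true
∈-replicate-⋆ []      = refl
∈-replicate-⋆ (b ∷ x) = ∈-replicate-⋆ x

dim-replicate-⋆ : ∀ n → dim (replicate n ⋆) ≡ 0
dim-replicate-⋆ zero    = refl
dim-replicate-⋆ (suc n) = dim-replicate-⋆ n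

cover-nonneg : ∀ {n} (w : Weights n) → (∀ z A → 0ℚ ≤ w z A) → ∀ z x → 0ℚ ≤ cover w z x
cover-nonneg {n} w 0≤w z x = ∑-nonneg (All.universal (λ A → []·-nonneg (x ∈C A) (0≤w z A)) (allSupports n))

cover-complement : ∀ {n} (w : Weights n) x → cover w false x + cover w true x ≡ 1ℚ →
                   ∀ z → cover w z x + cover w (not z) x ≡ 1ℚ
cover-complement w x total false = total
cover-complement w x total true  = trans (+-comm (cover w true x) (cover w false x)) total

1≤cost : ∀ {n} (w : Weights n) → (∀ z A → 0ℚ ≤ w z A) → ∀ x → cover w false x + cover w true x ≡ 1ℚ → 1ℚ ≤ cost w
1≤cost {n} w 0≤w x total = begin
  1ℚ                                                           ≡⟨ sym total ⟩
  cover w false x + cover w true x                             ≡⟨ sym (∑-+ (allSupports n) _ _) ⟩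
  ∑ (allSupports n) (λ A → [ x ∈C A ]· w false A + [ x ∈C A ]· w true A)
    ≡⟨ sym (∑-cong (allSupports n) (λ A → []·-+ (x ∈C A) (w false A) (w true A))) ⟩
  ∑ (allSupports n) (λ A → [ x ∈C A ]· (w false A + w true A))
    ≤⟨ ∑-mono-≤ (All.universal (λ A → [b]·q≤q*2^d (x ∈C A) (dim A) (+-nonneg (0≤w false A) (0≤w true A))) (allSupports n)) ⟩
  cost w                                                       ∎
  where
  open ≤-Reasoning
  [b]·q≤q*2^d : ∀ b d {q} → 0ℚ ≤ q → [ b ]· q ≤ q * ℕtoℚ 2 ^ℚ d
  [b]·q≤q*2^d true  d {q} 0≤q = subst (_≤ q * ℕtoℚ 2 ^ℚ d) (*-identityʳ q) (*-monoˡ-≤-nonneg q 0≤q (1≤^ d 1≤2))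
  [b]·q≤q*2^d false d     0≤q = *-nonneg 0≤q (^-nonneg d (≤-trans 0≤1 1≤2))

-- Repeating a partition t times

-- An entry stands for a sequence of labelled subcubes, remembering only their
-- intersection, the product of their weights and the number of each label.
record Entry (n : ℕ) : Set where
  constructor entry
  field
    support : Support n
    weight  : ℚ
    votes   : Bool → ℕ

open Entry

oneVote : Bool → Bool → ℕ
oneVote z y = if y ==B z then 1 else 0

layerAt : ∀ {n} → Weights n → Support n → List (Entry n)
layerAt w A = entry A (w false A) (oneVote false) ∷ entry A (w true A) (oneVote true) ∷ []

layer : ∀ {n} → Weights n → List (Entry n)
layer {n} w = concatMap (layerAt w) (allSupports n)

-- Sequences with empty intersection cover nothing and are dropped.
_⊗_ : ∀ {n} → Entry n → Entry n → List (Entry n)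
_⊗_ {n} e e′ = fromMaybe (Maybe.map product (support e ∩ support e′))
  where
  product : Support n → Entry n
  product C = entry C (weight e * weight e′) (λ y → votes e y ℕ.+ votes e′ y)

power : ∀ {n} → Weights n → ℕ → List (Entry n)
power {n} w zero    = entry (replicate n ⋆) 1ℚ (λ _ → 0) ∷ []
power     w (suc t) = concatMap (λ e → concatMap (e ⊗_) (layer w)) (power w t)

∑-power-suc : ∀ {n} (w : Weights n) t g →
              ∑ (power w (suc t)) g ≡ ∑ (power w t) (λ e → ∑ (layer w) (λ e′ → ∑ (e ⊗ e′) g))
∑-power-suc w t g = trans (∑-concatMap (λ e → concatMap (e ⊗_) (layer w)) (power w t) g)
                          (∑-cong (power w t) (λ e → ∑-concatMap (e ⊗_) (layer w) g))

WellFormed : ∀ {n} → ℕ → Entry n → Set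
WellFormed t e = 0ℚ ≤ weight e × votes e false ℕ.+ votes e true ≡ t

layer-wellFormed : ∀ {n} (w : Weights n) → (∀ z A → 0ℚ ≤ w z A) → All (WellFormed 1) (layer w)
layer-wellFormed {n} w 0≤w =
  All-concatMap⁺ (layerAt w) {allSupports n} (All.universal (λ A → (0≤w false A , refl) ∷ (0≤w true A , refl) ∷ []) _)

power-wellFormed : ∀ {n} (w : Weights n) → (∀ z A → 0ℚ ≤ w z A) → ∀ t → All (WellFormed t) (power w t)
power-wellFormed {n} w 0≤w zero    = (0≤1 , refl) ∷ []
power-wellFormed {n} w 0≤w (suc t) =
  All-concatMap⁺ (λ e → concatMap (e ⊗_) (layer w))
    (All.map (λ {e} wf → All-concatMap⁺ (e ⊗_) (All.map (λ {e′} → ⊗-wellFormed e e′ wf) (layer-wellFormed w 0≤w)))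
             (power-wellFormed w 0≤w t))
  where
  ⊗-wellFormed : ∀ e e′ → WellFormed t e → WellFormed 1 e′ → All (WellFormed (suc t)) (e ⊗ e′)
  ⊗-wellFormed e e′ (0≤we , Σe) (0≤we′ , Σe′) with support e ∩ support e′
  ... | nothing = []
  ... | just C  = (*-nonneg 0≤we 0≤we′ , votes-sum) ∷ []
    where
    votes-sum : (votes e false ℕ.+ votes e′ false) ℕ.+ (votes e true ℕ.+ votes e′ true) ≡ suc t
    votes-sum = trans (interchange (votes e false) _ _ _) (trans (cong₂ ℕ._+_ Σe Σe′) (ℕ.+-comm t 1))
      where
      interchange : ∀ p q r s → (p ℕ.+ q) ℕ.+ (r ℕ.+ s) ≡ (p ℕ.+ r) ℕ.+ (q ℕ.+ s)
      interchange = solve-∀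

charge : ∀ {n} → (Bool → ℚ) → Entry n → ℚ
charge ψ e = ψ false ^ℚ votes e false * ψ true ^ℚ votes e true

chargedWeight : ∀ {n} → (Bool → ℚ) → Entry n → ℚ
chargedWeight ψ e = weight e * charge ψ e

massAt : ∀ {n} → Cube n → (Bool → ℚ) → Entry n → ℚ
massAt x ψ e = [ x ∈C support e ]· chargedWeight ψ e

∑-⊗-massAt : ∀ {n} (x : Cube n) ψ e e′ → ∑ (e ⊗ e′) (massAt x ψ) ≡ massAt x ψ e * massAt x ψ e′
∑-⊗-massAt x ψ e e′ with support e ∩ support e′ | ∈-∩ x (support e) (support e′)
... | nothing | x∉C = sym (trans ([]·-*-[]· (x ∈C support e) (x ∈C support e′) (chargedWeight ψ e) (chargedWeight ψ e′))
                                (cong ([_]· _) (sym x∉C)))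
... | just C  | x∈C≡ = begin
  [ x ∈C C ]· (weight e * weight e′ * charge ψ (entry C (weight e * weight e′) (λ y → votes e y ℕ.+ votes e′ y))) + 0ℚ
    ≡⟨ +-identityʳ _ ⟩
  [ x ∈C C ]· (weight e * weight e′ * (ψ false ^ℚ (vf ℕ.+ vf′) * ψ true ^ℚ (vt ℕ.+ vt′)))
    ≡⟨ cong₂ [_]·_ x∈C≡ (cong (weight e * weight e′ *_) (cong₂ _*_ (^-+ (ψ false) vf vf′) (^-+ (ψ true) vt vt′))) ⟩
  [ x ∈C support e ∧ x ∈C support e′ ]· (weight e * weight e′ * ((ψ false ^ℚ vf * ψ false ^ℚ vf′) * (ψ true ^ℚ vt * ψ true ^ℚ vt′)))
    ≡⟨ cong ([ x ∈C support e ∧ x ∈C support e′ ]·_) (trans (cong (weight e * weight e′ *_) (*-interchange (ψ false ^ℚ vf) _ _ _))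
                                                           (*-interchange (weight e) (weight e′) _ _)) ⟩
  [ x ∈C support e ∧ x ∈C support e′ ]· (chargedWeight ψ e * chargedWeight ψ e′)
    ≡⟨ sym ([]·-*-[]· (x ∈C support e) (x ∈C support e′) (chargedWeight ψ e) (chargedWeight ψ e′)) ⟩
  massAt x ψ e * massAt x ψ e′ ∎
  where
  open ≡-Reasoning
  vf vf′ vt vt′ : ℕ
  vf  = votes e false
  vf′ = votes e′ false
  vt  = votes e true
  vt′ = votes e′ true

∑-layer-massAt : ∀ {n} (x : Cube n) ψ (w : Weights n) →
                 ∑ (layer w) (massAt x ψ) ≡ ψ false * cover w false x + ψ true * cover w true x
∑-layer-massAt {n} x ψ w = begin
  ∑ (layer w) (massAt x ψ)
    ≡⟨ ∑-concatMap (layerAt w) (allSupports n) (massAt x ψ) ⟩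
  ∑ (allSupports n) (λ A → ∑ (layerAt w A) (massAt x ψ))
    ≡⟨ ∑-cong (allSupports n) (λ A → pointwise (x ∈C A) (w false A) (w true A)) ⟩
  ∑ (allSupports n) (λ A → ψ false * [ x ∈C A ]· w false A + ψ true * [ x ∈C A ]· w true A)
    ≡⟨ ∑-+ (allSupports n) _ _ ⟩
  ∑ (allSupports n) (λ A → ψ false * [ x ∈C A ]· w false A) + ∑ (allSupports n) (λ A → ψ true * [ x ∈C A ]· w true A)
    ≡⟨ cong₂ _+_ (∑-*ˡ (allSupports n) (ψ false) _) (∑-*ˡ (allSupports n) (ψ true) _) ⟩
  ψ false * cover w false x + ψ true * cover w true x ∎
  where
  open ≡-Reasoning
  pointwise : ∀ b p q → [ b ]· (p * ((ψ false * 1ℚ) * 1ℚ)) + ([ b ]· (q * (1ℚ * (ψ true * 1ℚ))) + 0ℚ)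
                        ≡ ψ false * [ b ]· p + ψ true * [ b ]· q
  pointwise true  p q = rearrange (ψ false) (ψ true) p q
    where
    rearrange : ∀ a b p q → p * ((a * 1ℚ) * 1ℚ) + (q * (1ℚ * (b * 1ℚ)) + 0ℚ) ≡ a * p + b * q
    rearrange = solve 4 (λ a b p q → p :* ((a :* con 1ℚ) :* con 1ℚ) :+ (q :* (con 1ℚ :* (b :* con 1ℚ)) :+ con 0ℚ)
                                     := a :* p :+ b :* q) refl
  pointwise false p q = sym (cong₂ _+_ (*-zeroʳ (ψ false)) (*-zeroʳ (ψ true)))

∑-power-massAt : ∀ {n} (x : Cube n) ψ (w : Weights n) t →
                 ∑ (power w t) (massAt x ψ) ≡ (ψ false * cover w false x + ψ true * cover w true x) ^ℚ t
∑-power-massAt {n} x ψ w zero rewrite ∈-replicate-⋆ x = refl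
∑-power-massAt {n} x ψ w (suc t) = begin
  ∑ (power w (suc t)) (massAt x ψ)
    ≡⟨ ∑-power-suc w t (massAt x ψ) ⟩
  ∑ (power w t) (λ e → ∑ (layer w) (λ e′ → ∑ (e ⊗ e′) (massAt x ψ)))
    ≡⟨ ∑-cong (power w t) (λ e → ∑-cong (layer w) (∑-⊗-massAt x ψ e)) ⟩
  ∑ (power w t) (λ e → ∑ (layer w) (λ e′ → massAt x ψ e * massAt x ψ e′))
    ≡⟨ ∑-∑-* (power w t) (layer w) (massAt x ψ) (massAt x ψ) ⟩
  ∑ (power w t) (massAt x ψ) * ∑ (layer w) (massAt x ψ)
    ≡⟨ cong₂ _*_ (∑-power-massAt x ψ w t) (∑-layer-massAt x ψ w) ⟩
  v ^ℚ t * v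
    ≡⟨ *-comm (v ^ℚ t) v ⟩
  v ^ℚ suc t ∎
  where
  open ≡-Reasoning
  v : ℚ
  v = ψ false * cover w false x + ψ true * cover w true x

entryCost : ∀ {n} → Entry n → ℚ
entryCost e = weight e * ℕtoℚ 2 ^ℚ dim (support e)

entryCost-nonneg : ∀ {n} (e : Entry n) → 0ℚ ≤ weight e → 0ℚ ≤ entryCost e
entryCost-nonneg e 0≤we = *-nonneg 0≤we (^-nonneg (dim (support e)) (≤-trans 0≤1 1≤2))

∑-⊗-entryCost : ∀ {n} (e e′ : Entry n) → 0ℚ ≤ weight e → 0ℚ ≤ weight e′ →
                ∑ (e ⊗ e′) entryCost ≤ entryCost e * entryCost e′
∑-⊗-entryCost e e′ 0≤we 0≤we′ with support e ∩ support e′ | dim-∩ (support e) (support e′)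
... | nothing | _ = *-nonneg (entryCost-nonneg e 0≤we) (entryCost-nonneg e′ 0≤we′)
... | just C  | dimC≤ = begin
  weight e * weight e′ * 2^ (dim C) + 0ℚ
    ≡⟨ +-identityʳ _ ⟩
  weight e * weight e′ * 2^ (dim C)
    ≤⟨ *-monoˡ-≤-nonneg (weight e * weight e′) (*-nonneg 0≤we 0≤we′) (^-monoʳ-≤ 1≤2 dimC≤) ⟩
  weight e * weight e′ * 2^ (dim (support e) ℕ.+ dim (support e′))
    ≡⟨ cong (weight e * weight e′ *_) (^-+ (ℕtoℚ 2) (dim (support e)) _) ⟩
  weight e * weight e′ * (2^ (dim (support e)) * 2^ (dim (support e′)))
    ≡⟨ *-interchange (weight e) (weight e′) _ _ ⟩
  entryCost e * entryCost e′ ∎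
  where
  open ≤-Reasoning
  2^ : ℕ → ℚ
  2^ k = ℕtoℚ 2 ^ℚ k

∑-layer-entryCost : ∀ {n} (w : Weights n) → ∑ (layer w) entryCost ≡ cost w
∑-layer-entryCost {n} w = trans (∑-concatMap (layerAt w) (allSupports n) entryCost)
                                (∑-cong (allSupports n) (λ A → pointwise (w false A) (w true A) (ℕtoℚ 2 ^ℚ dim A)))
  where
  pointwise : ∀ a b c → a * c + (b * c + 0ℚ) ≡ (a + b) * c
  pointwise = solve 3 (λ a b c → a :* c :+ (b :* c :+ con 0ℚ) := (a :+ b) :* c) refl

cost-nonneg : ∀ {n} (w : Weights n) → (∀ z A → 0ℚ ≤ w z A) → 0ℚ ≤ cost w
cost-nonneg w 0≤w = subst (0ℚ ≤_) (∑-layer-entryCost w)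
                          (∑-nonneg (All.map (λ {e} wf → entryCost-nonneg e (proj₁ wf)) (layer-wellFormed w 0≤w)))

∑-power-entryCost : ∀ {n} (w : Weights n) → (∀ z A → 0ℚ ≤ w z A) → ∀ t → ∑ (power w t) entryCost ≤ cost w ^ℚ t
∑-power-entryCost {n} w 0≤w zero rewrite dim-replicate-⋆ n = ≤-refl
∑-power-entryCost {n} w 0≤w (suc t) = begin
  ∑ (power w (suc t)) entryCost
    ≡⟨ ∑-power-suc w t entryCost ⟩
  ∑ (power w t) (λ e → ∑ (layer w) (λ e′ → ∑ (e ⊗ e′) entryCost))
    ≤⟨ ∑-mono-≤ (All.map (λ {e} wf → ∑-mono-≤ (All.map (λ {e′} wf′ → ∑-⊗-entryCost e e′ (proj₁ wf) (proj₁ wf′))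
                                                        (layer-wellFormed w 0≤w)))
                         (power-wellFormed w 0≤w t)) ⟩
  ∑ (power w t) (λ e → ∑ (layer w) (λ e′ → entryCost e * entryCost e′))
    ≡⟨ ∑-∑-* (power w t) (layer w) entryCost entryCost ⟩
  ∑ (power w t) entryCost * ∑ (layer w) entryCost
    ≡⟨ cong (∑ (power w t) entryCost *_) (∑-layer-entryCost w) ⟩
  ∑ (power w t) entryCost * cost w
    ≤⟨ *-monoʳ-≤-nonneg (cost w) (cost-nonneg w 0≤w) (∑-power-entryCost w 0≤w t) ⟩
  cost w ^ℚ t * cost w
    ≡⟨ *-comm (cost w ^ℚ t) (cost w) ⟩
  cost w ^ℚ suc t ∎
  where open ≤-Reasoning

-- Majority vote

majority : ∀ {n} → Entry n → Bool
majority e = votes e false ℕ.<ᵇ votes e true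

majorityWeights : ∀ {n} → List (Entry n) → Weights n
majorityWeights R z A = ∑ R (λ e → [ support e ==ˢ A ]· [ majority e ==B z ]· weight e)

majorityWeights-nonneg : ∀ {n} {R : List (Entry n)} → All (λ e → 0ℚ ≤ weight e) R → ∀ z A → 0ℚ ≤ majorityWeights R z A
majorityWeights-nonneg 0≤R z A =
  ∑-nonneg (All.map (λ {e} 0≤we → []·-nonneg (support e ==ˢ A) ([]·-nonneg (majority e ==B z) 0≤we)) 0≤R)

cover-majorityWeights : ∀ {n} (R : List (Entry n)) z x →
                        cover (majorityWeights R) z x ≡ ∑ R (λ e → [ x ∈C support e ]· [ majority e ==B z ]· weight e)
cover-majorityWeights {n} R z x = begin
  ∑ (allSupports n) (λ A → [ x ∈C A ]· ∑ R (λ e → [ support e ==ˢ A ]· h e))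
    ≡⟨ ∑-cong (allSupports n) (λ A → []·-∑ (x ∈C A) R _) ⟩
  ∑ (allSupports n) (λ A → ∑ R (λ e → [ x ∈C A ]· [ support e ==ˢ A ]· h e))
    ≡⟨ ∑-comm (allSupports n) R _ ⟩
  ∑ R (λ e → ∑ (allSupports n) (λ A → [ x ∈C A ]· [ support e ==ˢ A ]· h e))
    ≡⟨ ∑-cong R (λ e → ∑-cong (allSupports n) (λ A → []·-comm (x ∈C A) (support e ==ˢ A) (h e))) ⟩
  ∑ R (λ e → ∑ (allSupports n) (λ A → [ support e ==ˢ A ]· [ x ∈C A ]· h e))
    ≡⟨ ∑-cong R (λ e → ∑-allSupports-==ˢ n (support e) (λ A → [ x ∈C A ]· h e)) ⟩
  ∑ R (λ e → [ x ∈C support e ]· h e) ∎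
  where
  open ≡-Reasoning
  h : Entry n → ℚ
  h e = [ majority e ==B z ]· weight e

[==B-false]+[==B-true] : ∀ b q → [ b ==B false ]· q + [ b ==B true ]· q ≡ q
[==B-false]+[==B-true] false q = +-identityʳ q
[==B-false]+[==B-true] true  q = +-identityˡ q

cost-majorityWeights : ∀ {n} (R : List (Entry n)) → cost (majorityWeights R) ≡ ∑ R entryCost
cost-majorityWeights {n} R = begin
  ∑ (allSupports n) (λ A → (W false A + W true A) * 2^ A)
    ≡⟨ ∑-cong (allSupports n) (λ A → cong (_* 2^ A) both-labels) ⟩
  ∑ (allSupports n) (λ A → ∑ R (λ e → [ support e ==ˢ A ]· weight e) * 2^ A)
    ≡⟨ ∑-cong (allSupports n) (λ A → trans (sym (∑-*ʳ R (2^ A) _))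
                                           (∑-cong R (λ e → []·-*ʳ (support e ==ˢ A) (weight e) (2^ A)))) ⟩
  ∑ (allSupports n) (λ A → ∑ R (λ e → [ support e ==ˢ A ]· (weight e * 2^ A)))
    ≡⟨ ∑-comm (allSupports n) R _ ⟩
  ∑ R (λ e → ∑ (allSupports n) (λ A → [ support e ==ˢ A ]· (weight e * 2^ A)))
    ≡⟨ ∑-cong R (λ e → ∑-allSupports-==ˢ n (support e) (λ A → weight e * 2^ A)) ⟩
  ∑ R entryCost ∎
  where
  open ≡-Reasoning
  W : Weights n
  W = majorityWeights R
  2^ : Support n → ℚ
  2^ A = ℕtoℚ 2 ^ℚ dim A
  both-labels : ∀ {A} → W false A + W true A ≡ ∑ R (λ e → [ support e ==ˢ A ]· weight e)
  both-labels {A} = trans (sym (∑-+ R _ _)) (∑-cong R (λ e → trans (sym ([]·-+ (support e ==ˢ A) _ _))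
                                                          (cong ([ support e ==ˢ A ]·_) ([==B-false]+[==B-true] (majority e) (weight e)))))

amplify : ∀ {n} → Weights n → ℕ → Weights n
amplify w t = majorityWeights (power w t)

amplify-nonneg : ∀ {n} (w : Weights n) → (∀ z A → 0ℚ ≤ w z A) → ∀ t z A → 0ℚ ≤ amplify w t z A
amplify-nonneg w 0≤w t = majorityWeights-nonneg (All.map proj₁ (power-wellFormed w 0≤w t))

amplify-cost : ∀ {n} (w : Weights n) → (∀ z A → 0ℚ ≤ w z A) → ∀ t → cost (amplify w t) ≤ cost w ^ℚ t
amplify-cost w 0≤w t = subst (_≤ cost w ^ℚ t) (sym (cost-majorityWeights (power w t))) (∑-power-entryCost w 0≤w t)

amplify-total : ∀ {n} (w : Weights n) x → cover w false x + cover w true x ≡ 1ℚ →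
                ∀ t → cover (amplify w t) false x + cover (amplify w t) true x ≡ 1ℚ
amplify-total {n} w x total t = begin
  cover (amplify w t) false x + cover (amplify w t) true x
    ≡⟨ cong₂ _+_ (cover-majorityWeights R false x) (cover-majorityWeights R true x) ⟩
  ∑ R (λ e → [ x ∈C support e ]· [ majority e ==B false ]· weight e)
    + ∑ R (λ e → [ x ∈C support e ]· [ majority e ==B true ]· weight e)
    ≡⟨ sym (∑-+ R _ _) ⟩
  ∑ R (λ e → [ x ∈C support e ]· [ majority e ==B false ]· weight e + [ x ∈C support e ]· [ majority e ==B true ]· weight e)
    ≡⟨ ∑-cong R (λ e → trans (sym ([]·-+ (x ∈C support e) _ _)) (cong ([ x ∈C support e ]·_) (trans
                         ([==B-false]+[==B-true] (majority e) (weight e)) (sym (unit-charge e))))) ⟩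
  ∑ R (massAt x (λ _ → 1ℚ))
    ≡⟨ ∑-power-massAt x (λ _ → 1ℚ) w t ⟩
  (1ℚ * cover w false x + 1ℚ * cover w true x) ^ℚ t
    ≡⟨ cong (_^ℚ t) (trans (cong₂ _+_ (*-identityˡ (cover w false x)) (*-identityˡ (cover w true x))) total) ⟩
  1ℚ ^ℚ t
    ≡⟨ 1^ t ⟩
  1ℚ ∎
  where
  open ≡-Reasoning
  R : List (Entry n)
  R = power w t
  unit-charge : ∀ e → chargedWeight (λ _ → 1ℚ) e ≡ weight e
  unit-charge e = trans (cong (weight e *_) (cong₂ _*_ (1^ (votes e false)) (1^ (votes e true)))) (*-identityʳ (weight e))

==B⇒≡ : ∀ {a b} → (a ==B b) ≡ true → a ≡ b
==B⇒≡ {true}  {true}  _ = refl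
==B⇒≡ {false} {false} _ = refl
==B⇒≡ {true}  {false} ()
==B⇒≡ {false} {true}  ()

minority-votes : ∀ {n} z (e : Entry n) → (majority e ==B not z) ≡ true → votes e z ℕ.≤ votes e (not z)
minority-votes false e maj≡true = ℕ.<⇒≤ (ℕ.<ᵇ⇒< (votes e false) (votes e true) (subst T (sym (==B⇒≡ maj≡true)) tt))
minority-votes true  e maj≡false = ℕ.≮⇒≥ (λ vf<vt → subst T (==B⇒≡ maj≡false) (ℕ.<⇒<ᵇ vf<vt))

favour : Bool → ℚ → ℚ → Bool → ℚ
favour z a b y = if y ==B z then a else b

charge-favour : ∀ {n} z a b (e : Entry n) → charge (favour z a b) e ≡ a ^ℚ votes e z * b ^ℚ votes e (not z)
charge-favour false a b e = refl
charge-favour true  a b e = *-comm (b ^ℚ votes e false) (a ^ℚ votes e true)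

favour-mixture : ∀ z a b (c : Bool → ℚ) → favour z a b false * c false + favour z a b true * c true ≡ a * c z + b * c (not z)
favour-mixture false a b c = refl
favour-mixture true  a b c = +-comm (b * c false) (a * c true)

votes-+-not : ∀ {n} z (e : Entry n) → votes e z ℕ.+ votes e (not z) ≡ votes e false ℕ.+ votes e true
votes-+-not false e = refl
votes-+-not true  e = ℕ.+-comm (votes e true) (votes e false)

-- A wrong majority has at most m of its 2m votes for z, and ε ≤ 1 - ε.
minority-massAt : ∀ {n} (x : Cube n) z {ε} m (e : Entry n) → 0ℚ ≤ ε → ε ≤ ½ → WellFormed (m ℕ.+ m) e →
                  ([ x ∈C support e ]· [ majority e ==B not z ]· weight e) * (ε * (1ℚ - ε)) ^ℚ m
                    ≤ massAt x (favour z ε (1ℚ - ε)) e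
minority-massAt x z {ε} m e 0≤ε ε≤½ (0≤we , votes≡m+m) with x ∈C support e | majority e ==B not z in minority
... | false | _     = ≤-reflexive (*-zeroˡ ((ε * (1ℚ - ε)) ^ℚ m))
... | true  | false = subst (_≤ chargedWeight (favour z ε (1ℚ - ε)) e) (sym (*-zeroˡ ((ε * (1ℚ - ε)) ^ℚ m)))
                            (*-nonneg 0≤we (subst (0ℚ ≤_) (sym (charge-favour z ε (1ℚ - ε) e))
                                                  (*-nonneg (^-nonneg (votes e z) 0≤ε) (^-nonneg (votes e (not z)) 0≤1-ε))))
  where
  0≤1-ε : 0ℚ ≤ 1ℚ - ε
  0≤1-ε = ≤-trans 0≤ε (ε≤½⇒ε≤1-ε ε≤½)
... | true  | true  = *-monoˡ-≤-nonneg (weight e) 0≤we (begin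
  (ε * (1ℚ - ε)) ^ℚ m
    ≤⟨ [s*l]^m≤s^i*l^j {m = m} (votes e z) (votes e (not z)) 0≤ε (ε≤½⇒ε≤1-ε ε≤½) (minority-votes z e minority) votes-z+¬z ⟩
  ε ^ℚ votes e z * (1ℚ - ε) ^ℚ votes e (not z)
    ≡⟨ sym (charge-favour z ε (1ℚ - ε) e) ⟩
  charge (favour z ε (1ℚ - ε)) e ∎)
  where
  open ≤-Reasoning
  votes-z+¬z : votes e z ℕ.+ votes e (not z) ≡ m ℕ.+ m
  votes-z+¬z = trans (votes-+-not z e) votes≡m+m

amplify-minority : ∀ {n} (w : Weights n) → (∀ z A → 0ℚ ≤ w z A) → ∀ x → cover w false x + cover w true x ≡ 1ℚ →
                   ∀ z {ε} → 0ℚ < ε → ε ≤ ½ → 1ℚ - ε ≤ cover w z x →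
                   ∀ m → cover (amplify w (m ℕ.+ m)) (not z) x ≤ (ℕtoℚ 4 * (ε * (1ℚ - ε))) ^ℚ m
amplify-minority {n} w 0≤w x total z {ε} 0<ε ε≤½ 1-ε≤c m = *-cancelʳ-≤-pos (P ^ℚ m) {{positive (^-pos m 0<P)}} (begin
  cover (amplify w (m ℕ.+ m)) (not z) x * P ^ℚ m
    ≡⟨ trans (cong (_* P ^ℚ m) (cover-majorityWeights R (not z) x)) (sym (∑-*ʳ R (P ^ℚ m) _)) ⟩
  ∑ R (λ e → ([ x ∈C support e ]· [ majority e ==B not z ]· weight e) * P ^ℚ m)
    ≤⟨ ∑-mono-≤ (All.map (λ {e} → minority-massAt x z m e (<⇒≤ 0<ε) ε≤½) (power-wellFormed w 0≤w (m ℕ.+ m))) ⟩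
  ∑ R (massAt x ψ)
    ≡⟨ ∑-power-massAt x ψ w (m ℕ.+ m) ⟩
  (ψ false * cover w false x + ψ true * cover w true x) ^ℚ (m ℕ.+ m)
    ≡⟨ cong (_^ℚ (m ℕ.+ m)) (favour-mixture z ε (1ℚ - ε) (λ y → cover w y x)) ⟩
  (ε * c + (1ℚ - ε) * r) ^ℚ (m ℕ.+ m)
    ≤⟨ ^-monoˡ-≤ (m ℕ.+ m) 0≤mixture (mixture-≤ ε≤½ c+r≡1 (1-ε≤p⇒q≤ε c+r≡1 1-ε≤c)) ⟩
  (P + P) ^ℚ (m ℕ.+ m)
    ≡⟨ trans (^-+ (P + P) m m) (sym (^-distrib-* (P + P) (P + P) m)) ⟩
  ((P + P) * (P + P)) ^ℚ m
    ≡⟨ cong (_^ℚ m) (square P) ⟩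
  (ℕtoℚ 4 * P * P) ^ℚ m
    ≡⟨ ^-distrib-* (ℕtoℚ 4 * P) P m ⟩
  (ℕtoℚ 4 * P) ^ℚ m * P ^ℚ m ∎)
  where
  open ≤-Reasoning
  R : List (Entry n)
  R = power w (m ℕ.+ m)
  P c r : ℚ
  P = ε * (1ℚ - ε)
  c = cover w z x
  r = cover w (not z) x
  ψ : Bool → ℚ
  ψ = favour z ε (1ℚ - ε)
  c+r≡1 : c + r ≡ 1ℚ
  c+r≡1 = cover-complement w x total z
  0≤1-ε : 0ℚ ≤ 1ℚ - ε
  0≤1-ε = ≤-trans (<⇒≤ 0<ε) (ε≤½⇒ε≤1-ε ε≤½)
  0<P : 0ℚ < P
  0<P = *-pos 0<ε (<-≤-trans 0<ε (ε≤½⇒ε≤1-ε ε≤½))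
  0≤mixture : 0ℚ ≤ ε * c + (1ℚ - ε) * r
  0≤mixture = +-nonneg (*-nonneg (<⇒≤ 0<ε) (cover-nonneg w 0≤w z x)) (*-nonneg 0≤1-ε (cover-nonneg w 0≤w (not z) x))
  square : ∀ P → (P + P) * (P + P) ≡ ℕtoℚ 4 * P * P
  square = solve 1 (λ P → (P :+ P) :* (P :+ P) := con (ℕtoℚ 4) :* P :* P) refl

amplify-feasible : ∀ {n} {f : Cube n → Bool} {ε δ} {w : Weights n} → Feasible f ε w → 0ℚ < ε → ε ≤ ½ →
                   ∀ m → (ℕtoℚ 4 * (ε * (1ℚ - ε))) ^ℚ m ≤ δ → Feasible f δ (amplify w (m ℕ.+ m))
amplify-feasible {f = f} {w = w} (0≤w , correct , total) 0<ε ε≤½ m bound =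
  amplify-nonneg w 0≤w (m ℕ.+ m) ,
  (λ x → q≤δ⇒1-δ≤p (cover-complement (amplify w (m ℕ.+ m)) x (amplify-total w x (total x) (m ℕ.+ m)) (f x))
                   (≤-trans (amplify-minority w 0≤w x (total x) (f x) 0<ε ε≤½ (correct x) m) bound)) ,
  (λ x → amplify-total w x (total x) (m ℕ.+ m))

amplify-cost-^ : ∀ {n} (w : Weights n) → (∀ z A → 0ℚ ≤ w z A) → ∀ x → cover w false x + cover w true x ≡ 1ℚ →
                 ∀ t l a → l ℕ.* t ℕ.≤ a → cost (amplify w t) ^ℚ l ≤ cost w ^ℚ a
amplify-cost-^ w 0≤w x total t l a lt≤a = begin
  cost (amplify w t) ^ℚ l     ≤⟨ ^-monoˡ-≤ l (cost-nonneg (amplify w t) (amplify-nonneg w 0≤w t)) (amplify-cost w 0≤w t) ⟩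
  (cost w ^ℚ t) ^ℚ l          ≡⟨ sym (^-* (cost w) l t) ⟩
  cost w ^ℚ (l ℕ.* t)         ≤⟨ ^-monoʳ-≤ (1≤cost w 0≤w x total) lt≤a ⟩
  cost w ^ℚ a                 ∎
  where open ≤-Reasoning

claimA2 : ∃[ C ] ((n : ℕ) (f : Cube n → Bool) (ε δ : ℚ) →
              0ℚ < δ → δ < ε → ε < ½ →
              (w : Weights n) → Feasible f ε w →
              ∃[ w′ ] (Feasible f δ w′ ×
                ((k a b : ℕ) →
                  1ℚ ≤ δ * (ℕtoℚ 2 ^ℚ k) →
                  ℕtoℚ C * ℕtoℚ k * ℕtoℚ (suc b) ≤ ℕtoℚ a * ((½ - ε) * (½ - ε)) →
                  cost w′ ^ℚ suc b ≤ cost w ^ℚ a)))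
claimA2 = 1 , λ n f ε δ 0<δ δ<ε ε<½ w feasible →
  let 0<ε = <-trans 0<δ δ<ε
      ε≤½ = <⇒≤ ε<½
      0<½-ε = p<q⇒0<q-p ε<½
      0<g = *-pos 0<½-ε 0<½-ε
      (s , 1≤s4g , s4g≤2) = multiple-between-1-and-2 (*-pos (positive⁻¹ (ℕtoℚ 4)) 0<g) (4[½-ε]²≤1 (<⇒≤ 0<ε) ε≤½)
      (j , 1≤δ2^j , j-least) = least-doubling-exponent 0<δ
      m = j ℕ.* s
      (0≤w , _ , total) = feasible
  in amplify w (m ℕ.+ m)
   , amplify-feasible {δ = δ} feasible 0<ε ε≤½ m ([4ε[1-ε]]^[j*s]≤δ s j (<⇒≤ 0<ε) ε≤½ 1≤s4g 1≤δ2^j)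
   , λ k a b 1≤δ2^k k[b+1]≤ag →
       amplify-cost-^ w 0≤w (replicate n false) (total (replicate n false)) (m ℕ.+ m) (suc b) a
         (amplification-exponent-≤ s j k a b 0<g s4g≤2 (j-least k 1≤δ2^k) k[b+1]≤ag)
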